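{- Let $k>0$ and let $A,B$ be sets such that $A\leq_{bT}B$ and $B$ is $\omega^k$-c.e. Then $A$ is $\omega^k$-c.e.
   Context: $A\leq_{bT}B$ means there are $i,j$ with $\varphi_j$ total and $A(x)=\Phi_i^{B\upharpoonright\varphi_j(x)}(x)$ for all $x$, where $\varphi_e$ are the partial computable functions, $\Phi_e$ the Turing functionals, and $B\upharpoonright x=\{n\in B:n\leq x\}$. Fix a canonical computable coding of the ordinals below $\omega^\omega$. For an ordinal $\alpha\geq\omega$, a set $A$ is $\alpha$-c.e. if there is a partial computable $\psi:\omega\times\alpha\to\{0,1\}$ such that for every $n$ there is $\beta<\alpha$ with $\psi(n,\beta)\downarrow$, and $A(n)=\psi(n,\gamma)$ where $\gamma$ is least with $\psi(n,\gamma)\downarrow$. -}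

module Defs where

open import Data.Nat using (ℕ; zero; suc; _<_; _≤?_)
open import Data.Bool using (Bool; true; false; if_then_else_)
open import Data.Fin using (Fin)
open import Data.Vec using (Vec; []; _∷_; lookup)
open import Data.Sum using (_⊎_)
open import Data.Product using (Σ; ∃; _×_; _,_)
open import Relation.Nullary using (¬_)
open import Relation.Nullary.Decidable using (⌊_⌋)
open import Relation.Binary.PropositionalEquality using (_≡_)

Set' : Set
Set' = ℕ → Bool

χ : Bool → ℕ
χ true  = 1
χ false = 0

-- Oracle partial recursive (Kleene μ-recursive) functions of arity n.
-- These are the codes both for partial computable functions (run with the
-- empty oracle) and for Turing functionals (run with an oracle).

data PR : ℕ → Set where
  zer   : ∀ {n} → PR n
  succ  : PR 1
  proj  : ∀ {n} → Fin n → PR n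
  comp  : ∀ {m n} → PR m → Vec (PR n) m → PR n
  prec  : ∀ {n} → PR n → PR (suc (suc n)) → PR (suc n)
  mu    : ∀ {n} → PR (suc n) → PR n
  orc   : PR 1

mutual
  data Eval (O : Set') : ∀ {n} → PR n → Vec ℕ n → ℕ → Set where
    e-zer  : ∀ {n} {xs : Vec ℕ n} → Eval O zer xs 0
    e-succ : ∀ {x} → Eval O succ (x ∷ []) (suc x)
    e-proj : ∀ {n} {i : Fin n} {xs} → Eval O (proj i) xs (lookup xs i)
    e-comp : ∀ {m n} {f : PR m} {gs : Vec (PR n) m} {xs ys y} →
             EvalAll O gs xs ys → Eval O f ys y → Eval O (comp f gs) xs y
    e-prec0 : ∀ {n} {f : PR n} {g xs y} →
              Eval O f xs y → Eval O (prec f g) (0 ∷ xs) y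
    e-precS : ∀ {n} {f : PR n} {g x xs r y} →
              Eval O (prec f g) (x ∷ xs) r → Eval O g (x ∷ r ∷ xs) y →
              Eval O (prec f g) (suc x ∷ xs) y
    e-mu   : ∀ {n} {f : PR (suc n)} {xs z} →
             Eval O f (z ∷ xs) 0 →
             (∀ w → w < z → Σ ℕ λ v → Eval O f (w ∷ xs) (suc v)) →
             Eval O (mu f) xs z
    e-orc  : ∀ {x} → Eval O orc (x ∷ []) (χ (O x))

  data EvalAll (O : Set') : ∀ {m n} → Vec (PR n) m → Vec ℕ n → Vec ℕ m → Set where
    []  : ∀ {n} {xs : Vec ℕ n} → EvalAll O [] xs []
    _∷_ : ∀ {m n} {g : PR n} {gs : Vec (PR n) m} {xs y ys} →
          Eval O g xs y → EvalAll O gs xs ys → EvalAll O (g ∷ gs) xs (y ∷ ys)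

∅ : Set'
∅ _ = false

φ⟨_⟩_↦_ : ∀ {n} → PR n → Vec ℕ n → ℕ → Set
φ⟨ e ⟩ xs ↦ y = Eval ∅ e xs y

Total : PR 1 → Set
Total e = ∀ x → Σ ℕ λ y → φ⟨ e ⟩ (x ∷ []) ↦ y

_↾_ : Set' → ℕ → Set'
(B ↾ m) n = if ⌊ n ≤? m ⌋ then B n else false

_≤bT_ : Set' → Set' → Set
A ≤bT B = Σ (PR 1) λ i → Σ (PR 1) λ j →
  Total j ×
  (∀ x → Σ ℕ λ m → (φ⟨ j ⟩ (x ∷ []) ↦ m) × Eval (B ↾ m) i (x ∷ []) (χ (A x)))

-- Ordinals below ω^k: Cantor normal form coefficient vectors
-- (c_{k-1}, …, c_0) ↔ ω^{k-1}·c_{k-1} + … + c_0, ordered lexicographically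
-- (most significant coefficient first).

data _<lex_ : ∀ {k} → Vec ℕ k → Vec ℕ k → Set where
  here  : ∀ {k a b} {xs ys : Vec ℕ k} → a < b → (a ∷ xs) <lex (b ∷ ys)
  there : ∀ {k a} {xs ys : Vec ℕ k} → xs <lex ys → (a ∷ xs) <lex (a ∷ ys)

ωPow-ce : ℕ → Set' → Set
ωPow-ce k A = Σ (PR (suc k)) λ ψ →
  (∀ n (β : Vec ℕ k) y → φ⟨ ψ ⟩ (n ∷ β) ↦ y → (y ≡ 0 ⊎ y ≡ 1)) ×
  (∀ n → Σ (Vec ℕ k) λ γ → Σ ℕ λ y →
     (φ⟨ ψ ⟩ (n ∷ γ) ↦ y) ×
     (∀ δ → δ <lex γ → ∀ z → ¬ (φ⟨ ψ ⟩ (n ∷ δ) ↦ z)) ×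
     χ (A n) ≡ y)

module Submission where

-- Let ψ witness that B is ω^k-c.e., with γₙ ∈ ℕ^k the lexicographically
-- least point where ψ(n,-) converges, and let A(x) = Φᵢ^(B↾m)(x) with
-- m = φⱼ(x).  A point δ ∈ ℕ^k for A is read coordinatewise as k codes of
-- finite sequences (iterated Cantor pairing), giving a "slice" δ[n] ∈ ℕ^k
-- for every n.  The new approximation ψA(x,δ) computes m = φⱼ(x), demands
-- that ψ(n,δ[n]) converges for all n ≤ m, and then runs Φᵢ, answering an
-- oracle query q by ψ(q,δ[q]) if q ≤ m and by 0 otherwise.  At the point
-- δ* whose slices are γ₀,…,γₘ this computes A(x); and any δ where ψA(x,-)
-- converges has δ[n] ≥lex γₙ for n ≤ m, which forces δ ≥lex δ* because
-- sequence coding is monotone and a code is at least the code of its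
-- decoded prefix.  So δ* is the least point of convergence.

open import Defs
open import Data.Nat using (ℕ; zero; suc; pred; _<_; _≤_; _+_; _∸_; z≤n; s≤s; _<?_; _≤?_)
open import Data.Nat.Properties
open import Data.Bool using (true; false)
open import Data.Fin using (Fin; zero; suc; _↑ˡ_; _↑ʳ_)
open import Data.Vec using (Vec; []; _∷_; lookup; tabulate; _++_)
open import Data.Vec.Properties using (lookup-++ˡ; lookup-++ʳ; tabulate∘lookup; tabulate-cong; lookup∘tabulate)
open import Data.Product using (Σ; _×_; _,_; proj₁; proj₂)
open import Data.Sum using (_⊎_; inj₁; inj₂)
open import Data.Empty using (⊥-elim)
open import Relation.Binary using (tri<; tri≈; tri>)
open import Relation.Binary.PropositionalEquality
open import Relation.Nullary using (¬_; yes; no)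

-- Evaluation is deterministic; for μ-minimisation this uses that the
-- convergent value 0 at the smaller search point contradicts the other
-- derivation's nonzero value there.
mutual
  eval-det : ∀ {O n} {p : PR n} {xs y y'} → Eval O p xs y → Eval O p xs y' → y ≡ y'
  eval-det e-zer e-zer = refl
  eval-det e-succ e-succ = refl
  eval-det e-proj e-proj = refl
  eval-det (e-comp a f) (e-comp a' f') with evalAll-det a a'
  ... | refl = eval-det f f'
  eval-det (e-prec0 a) (e-prec0 b) = eval-det a b
  eval-det (e-precS a b) (e-precS a' b') with eval-det a a'
  ... | refl = eval-det b b'
  eval-det (e-mu {z = z} a h) (e-mu {z = z'} a' h') with <-cmp z z'
  ... | tri< lt _ _ with eval-det a (proj₂ (h' z lt))
  ...   | ()
  eval-det (e-mu a h) (e-mu a' h') | tri≈ _ eq _ = eq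
  eval-det (e-mu {z = z} a h) (e-mu {z = z'} a' h') | tri> _ _ gt with eval-det a' (proj₂ (h z' gt))
  ...   | ()
  eval-det e-orc e-orc = refl

  evalAll-det : ∀ {O m n} {gs : Vec (PR n) m} {xs ys ys'} →
                EvalAll O gs xs ys → EvalAll O gs xs ys' → ys ≡ ys'
  evalAll-det [] [] = refl
  evalAll-det (a ∷ as) (b ∷ bs) = cong₂ _∷_ (eval-det a b) (evalAll-det as bs)

vec-ext : ∀ {n} {xs ys : Vec ℕ n} → (∀ i → lookup xs i ≡ lookup ys i) → xs ≡ ys
vec-ext {xs = xs} {ys} h = trans (sym (tabulate∘lookup xs)) (trans (tabulate-cong h) (tabulate∘lookup ys))

evalAll-tabulate : ∀ {O m n} (gs : Fin m → PR n) {xs} (ys : Fin m → ℕ) →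
                   (∀ i → Eval O (gs i) xs (ys i)) → EvalAll O (tabulate gs) xs (tabulate ys)
evalAll-tabulate {m = zero} gs ys h = []
evalAll-tabulate {m = suc m} gs ys h =
  h zero ∷ evalAll-tabulate (λ i → gs (suc i)) (λ i → ys (suc i)) (λ i → h (suc i))

evalAll-lookup : ∀ {O m n} (gs : Fin m → PR n) {xs zs} →
                 EvalAll O (tabulate gs) xs zs → ∀ i → Eval O (gs i) xs (lookup zs i)
evalAll-lookup {m = suc m} gs (a ∷ as) zero = a
evalAll-lookup {m = suc m} gs (a ∷ as) (suc i) = evalAll-lookup (λ i → gs (suc i)) as i

evalAll-++ : ∀ {O m m' n} {gs : Vec (PR n) m} {hs : Vec (PR n) m'} {xs ys zs} →
             EvalAll O gs xs ys → EvalAll O hs xs zs → EvalAll O (gs ++ hs) xs (ys ++ zs)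
evalAll-++ [] b = b
evalAll-++ (a ∷ as) b = a ∷ evalAll-++ as b

projs : ∀ {n m} → (Fin m → Fin n) → Vec (PR n) m
projs f = tabulate (λ i → proj (f i))

evalAll-projs : ∀ {O n m} (f : Fin m → Fin n) {xs : Vec ℕ n} (ys : Vec ℕ m) →
                (∀ i → lookup xs (f i) ≡ lookup ys i) → EvalAll O (projs f) xs ys
evalAll-projs f {xs} ys h = subst (EvalAll _ (projs f) xs)
  (vec-ext (λ i → trans (lookup∘tabulate _ i) (h i)))
  (evalAll-tabulate (λ i → proj (f i)) (λ i → lookup xs (f i)) (λ i → e-proj))

eval-proj⁻¹ : ∀ {O n} {j : Fin n} {xs y} → Eval O (proj j) xs y → lookup xs j ≡ y
eval-proj⁻¹ e-proj = refl

evalAll-projs⁻¹ : ∀ {O n m} (f : Fin m → Fin n) {xs : Vec ℕ n} {ys : Vec ℕ m} →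
                  EvalAll O (projs f) xs ys → ∀ i → lookup xs (f i) ≡ lookup ys i
evalAll-projs⁻¹ f ev i = eval-proj⁻¹ (evalAll-lookup (λ i → proj (f i)) ev i)

-- Given Q of arity 1+e, every oracle
-- program p of arity n compiles to a plain program of arity n+e in which
-- each oracle query q becomes Q(q, es) for the trailing parameters es.
module ReplaceOracle {e : ℕ} (Q : PR (suc e)) where

  params : ∀ n → Vec (PR (n + e)) e
  params n = projs (λ i → n ↑ʳ i)

  evalAll-params : ∀ {O n} (xs : Vec ℕ n) (es : Vec ℕ e) → EvalAll O (params n) (xs ++ es) es
  evalAll-params xs es = evalAll-projs _ es (λ i → lookup-++ʳ xs es i)

  mutual
    compile : ∀ {n} → PR n → PR (n + e)
    compile zer = zer
    compile succ = comp succ (proj zero ∷ [])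
    compile (proj i) = proj (i ↑ˡ e)
    compile (comp {n = n} f gs) = comp (compile f) (compileAll gs ++ params n)
    compile (prec f g) = prec (compile f) (compile g)
    compile (mu f) = mu (compile f)
    compile orc = comp Q (proj zero ∷ params 1)

    compileAll : ∀ {m n} → Vec (PR n) m → Vec (PR (n + e)) m
    compileAll [] = []
    compileAll (g ∷ gs) = compile g ∷ compileAll gs

  module _ {O : Set'} (es : Vec ℕ e) (Q-computes-O : ∀ q → Eval ∅ Q (q ∷ es) (χ (O q))) where
    mutual
      compile-sound : ∀ {n} {p : PR n} {xs y} → Eval O p xs y → Eval ∅ (compile p) (xs ++ es) y
      compile-sound e-zer = e-zer
      compile-sound e-succ = e-comp (e-proj ∷ []) e-succ
      compile-sound (e-proj {i = i} {xs = xs}) = subst (Eval ∅ _ (xs ++ es)) (lookup-++ˡ xs es i) e-proj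
      compile-sound (e-comp {xs = xs} a f) =
        e-comp (evalAll-++ (compileAll-sound a) (evalAll-params xs es)) (compile-sound f)
      compile-sound (e-prec0 a) = e-prec0 (compile-sound a)
      compile-sound (e-precS a b) = e-precS (compile-sound a) (compile-sound b)
      compile-sound (e-mu a h) = e-mu (compile-sound a) (λ w lt → proj₁ (h w lt) , compile-sound (proj₂ (h w lt)))
      compile-sound (e-orc {x = x}) = e-comp (e-proj ∷ evalAll-params (x ∷ []) es) (Q-computes-O x)

      compileAll-sound : ∀ {m n} {gs : Vec (PR n) m} {xs ys} →
                         EvalAll O gs xs ys → EvalAll ∅ (compileAll gs) (xs ++ es) ys
      compileAll-sound [] = []
      compileAll-sound (a ∷ as) = compile-sound a ∷ compileAll-sound as

predP : PR 1
predP = prec zer (proj zero)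

eval-pred : ∀ {O} x → Eval O predP (x ∷ []) (pred x)
eval-pred zero = e-prec0 e-zer
eval-pred (suc x) = e-precS (eval-pred x) e-proj

monusP : PR 2
monusP = prec (proj zero) (comp predP (proj (suc zero) ∷ []))

eval-monus : ∀ {O} n a → Eval O monusP (n ∷ a ∷ []) (a ∸ n)
eval-monus zero a = e-prec0 e-proj
eval-monus {O} (suc n) a = subst (Eval O monusP (suc n ∷ a ∷ [])) (pred[m∸n]≡m∸[1+n] a n)
  (e-precS (eval-monus n a) (e-comp (e-proj ∷ []) (eval-pred (a ∸ n))))

addP : PR 2
addP = prec (proj zero) (comp succ (proj (suc zero) ∷ []))

eval-add : ∀ {O} x y → Eval O addP (x ∷ y ∷ []) (x + y)
eval-add zero y = e-prec0 e-proj
eval-add (suc x) y = e-precS (eval-add x y) (e-comp (e-proj ∷ []) e-succ)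

sg : ℕ → ℕ
sg zero = 0
sg (suc _) = 1

sg-χ : ∀ b → sg (χ b) ≡ χ b
sg-χ true = refl
sg-χ false = refl

sgP : PR 1
sgP = prec zer (comp succ (zer ∷ []))

eval-sg : ∀ {O} w → Eval O sgP (w ∷ []) (sg w)
eval-sg zero = e-prec0 e-zer
eval-sg (suc w) = e-precS (eval-sg w) (e-comp (e-zer ∷ []) e-succ)

sgP-01 : ∀ {O w y} → Eval O sgP (w ∷ []) y → y ≡ 0 ⊎ y ≡ 1
sgP-01 (e-prec0 e-zer) = inj₁ refl
sgP-01 (e-precS _ (e-comp (e-zer ∷ []) e-succ)) = inj₂ refl

tri : ℕ → ℕ
tri zero = 0
tri (suc z) = suc (z + tri z)

triP : PR 1
triP = prec zer (comp succ (comp addP (proj zero ∷ proj (suc zero) ∷ []) ∷ []))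

eval-tri : ∀ {O} z → Eval O triP (z ∷ []) (tri z)
eval-tri zero = e-prec0 e-zer
eval-tri (suc z) =
  e-precS (eval-tri z) (e-comp (e-comp (e-proj ∷ e-proj ∷ []) (eval-add z (tri z)) ∷ []) e-succ)

tri-mono : ∀ {m n} → m ≤ n → tri m ≤ tri n
tri-mono {m} {zero} z≤n = z≤n
tri-mono {zero} {suc n} z≤n = z≤n
tri-mono {suc m} {suc n} (s≤s le) = s≤s (+-mono-≤ le (tri-mono le))

diagonal-exists : ∀ v → Σ ℕ λ z → tri z ≤ v × v < tri (suc z)
diagonal-exists zero = 0 , z≤n , s≤s z≤n
diagonal-exists (suc v) with diagonal-exists v
... | z , a , b with suc v <? tri (suc z)
...   | yes lt = z , ≤-trans a (n≤1+n v) , lt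
...   | no nlt = suc z , ≮⇒≥ nlt , s≤s (≤-trans b (m≤n+m _ (suc z)))

diagonal-unique : ∀ {z z' v} → tri z ≤ v → v < tri (suc z) → tri z' ≤ v → v < tri (suc z') → z ≡ z'
diagonal-unique {z} {z'} a b a' b' with <-cmp z z'
... | tri< lt _ _ = ⊥-elim (<-irrefl refl (<-≤-trans b (≤-trans (tri-mono lt) a')))
... | tri≈ _ eq _ = eq
... | tri> _ _ gt = ⊥-elim (<-irrefl refl (<-≤-trans b' (≤-trans (tri-mono gt) a)))

diagonal : ℕ → ℕ
diagonal v = proj₁ (diagonal-exists v)

-- diagonalP v = μz. (v+1) ∸ tri (z+1) = 0.
diagonalP : PR 1
diagonalP = mu (comp monusP (comp triP (comp succ (proj zero ∷ []) ∷ []) ∷ comp succ (proj (suc zero) ∷ []) ∷ []))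

-- At the diagonal index the test value is 0, below it the value is positive.
eval-diagonal : ∀ {O} v → Eval O diagonalP (v ∷ []) (diagonal v)
eval-diagonal {O} v with diagonal-exists v
... | z , a , b = e-mu (subst (Eval O _ (z ∷ v ∷ [])) (m≤n⇒m∸n≡0 b) (test z))
  (λ w lt → (v ∸ tri (suc w)) , subst (Eval O _ (w ∷ v ∷ [])) (+-∸-assoc 1 (≤-trans (tri-mono lt) a)) (test w))
  where
  test : ∀ z → Eval O _ (z ∷ v ∷ []) (suc v ∸ tri (suc z))
  test z = e-comp (e-comp (e-comp (e-proj ∷ []) e-succ ∷ []) (eval-tri (suc z)) ∷ e-comp (e-proj ∷ []) e-succ ∷ [])
                  (eval-monus (tri (suc z)) (suc v))

⟪_,_⟫ : ℕ → ℕ → ℕ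
⟪ a , b ⟫ = tri (a + b) + b

unpairR : ℕ → ℕ
unpairR v = v ∸ tri (diagonal v)

unpairL : ℕ → ℕ
unpairL v = diagonal v ∸ unpairR v

unpairRP : PR 1
unpairRP = comp monusP (comp triP (diagonalP ∷ []) ∷ proj zero ∷ [])

unpairLP : PR 1
unpairLP = comp monusP (unpairRP ∷ diagonalP ∷ [])

eval-unpairR : ∀ {O} v → Eval O unpairRP (v ∷ []) (unpairR v)
eval-unpairR v = e-comp (e-comp (eval-diagonal v ∷ []) (eval-tri (diagonal v)) ∷ e-proj ∷ []) (eval-monus _ v)

eval-unpairL : ∀ {O} v → Eval O unpairLP (v ∷ []) (unpairL v)
eval-unpairL v = e-comp (eval-unpairR v ∷ eval-diagonal v ∷ []) (eval-monus _ _)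

diagonal-pair : ∀ a b → diagonal ⟪ a , b ⟫ ≡ a + b
diagonal-pair a b with diagonal-exists ⟪ a , b ⟫
... | z , p , q = diagonal-unique p q (m≤m+n _ b)
   (s≤s (≤-trans (≤-reflexive (+-comm (tri (a + b)) b)) (+-monoˡ-≤ (tri (a + b)) (m≤n+m b a))))

unpairR-pair : ∀ a b → unpairR ⟪ a , b ⟫ ≡ b
unpairR-pair a b rewrite diagonal-pair a b = m+n∸m≡n (tri (a + b)) b

unpairL-pair : ∀ a b → unpairL ⟪ a , b ⟫ ≡ a
unpairL-pair a b rewrite unpairR-pair a b | diagonal-pair a b = m+n∸n≡m a b

unpairR≤diagonal : ∀ v → unpairR v ≤ diagonal v
unpairR≤diagonal v with diagonal-exists v
... | z , p , q = ≤-trans (∸-monoˡ-≤ (tri z) (≤-pred q)) (≤-reflexive (m+n∸n≡m z (tri z)))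

pair-unpair : ∀ v → ⟪ unpairL v , unpairR v ⟫ ≡ v
pair-unpair v = begin
    tri (unpairL v + unpairR v) + unpairR v ≡⟨ cong (λ u → tri u + unpairR v) (m∸n+n≡m (unpairR≤diagonal v)) ⟩
    tri (diagonal v) + (v ∸ tri (diagonal v)) ≡⟨ m+[n∸m]≡n (proj₁ (proj₂ (diagonal-exists v))) ⟩
    v ∎
  where open ≡-Reasoning

pair-mono : ∀ {a a' b b'} → a ≤ a' → b ≤ b' → ⟪ a , b ⟫ ≤ ⟪ a' , b' ⟫
pair-mono aa bb = +-mono-≤ (tri-mono (+-mono-≤ aa bb)) bb

encode : ℕ → (ℕ → ℕ) → ℕ
encode zero t = ⟪ t 0 , 0 ⟫
encode (suc m) t = ⟪ t 0 , encode m (λ n → t (suc n)) ⟫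

dropR : ℕ → ℕ → ℕ
dropR zero v = v
dropR (suc n) v = unpairR (dropR n v)

entry : ℕ → ℕ → ℕ
entry n v = unpairL (dropR n v)

entryP : PR 2
entryP = comp unpairLP (prec (proj zero) (comp unpairRP (proj (suc zero) ∷ [])) ∷ [])

eval-entry : ∀ {O} n v → Eval O entryP (n ∷ v ∷ []) (entry n v)
eval-entry n v = e-comp (eval-dropR n ∷ []) (eval-unpairL _)
  where
  eval-dropR : ∀ {O} n → Eval O (prec (proj zero) (comp unpairRP (proj (suc zero) ∷ []))) (n ∷ v ∷ []) (dropR n v)
  eval-dropR zero = e-prec0 e-proj
  eval-dropR (suc n) = e-precS (eval-dropR n) (e-comp (e-proj ∷ []) (eval-unpairR _))

dropR-suc : ∀ n v → dropR (suc n) v ≡ dropR n (unpairR v)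
dropR-suc zero v = refl
dropR-suc (suc n) v = cong unpairR (dropR-suc n v)

entry-encode : ∀ m t n → n ≤ m → entry n (encode m t) ≡ t n
entry-encode zero t zero _ = unpairL-pair _ _
entry-encode (suc m) t zero _ = unpairL-pair _ _
entry-encode (suc m) t (suc n) (s≤s le) = begin
    unpairL (dropR (suc n) (encode (suc m) t))  ≡⟨ cong unpairL (dropR-suc n _) ⟩
    unpairL (dropR n (unpairR (encode (suc m) t))) ≡⟨ cong (entry n) (unpairR-pair (t 0) _) ⟩
    entry n (encode m (λ n → t (suc n)))        ≡⟨ entry-encode m _ n le ⟩
    t (suc n) ∎
  where open ≡-Reasoning

encode-mono : ∀ m {t t'} → (∀ n → n ≤ m → t n ≤ t' n) → encode m t ≤ encode m t'
encode-mono zero h = pair-mono (h 0 z≤n) ≤-refl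
encode-mono (suc m) h = pair-mono (h 0 z≤n) (encode-mono m (λ n le → h (suc n) (s≤s le)))

encode-entries≤ : ∀ m v → encode m (λ n → entry n v) ≤ v
encode-entries≤ zero v = ≤-trans (pair-mono ≤-refl z≤n) (≤-reflexive (pair-unpair v))
encode-entries≤ (suc m) v = ≤-trans (pair-mono (≤-refl {unpairL v}) tail≤) (≤-reflexive (pair-unpair v))
  where
  tail≤ : encode m (λ n → entry (suc n) v) ≤ unpairR v
  tail≤ = begin
    encode m (λ n → entry (suc n) v)     ≤⟨ encode-mono m (λ n _ → ≤-reflexive (cong unpairL (dropR-suc n v))) ⟩
    encode m (λ n → entry n (unpairR v)) ≤⟨ encode-entries≤ m (unpairR v) ⟩
    unpairR v ∎
    where open ≤-Reasoning

slice : ∀ {k} → ℕ → Vec ℕ k → Vec ℕ k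
slice n δ = tabulate (λ i → entry n (lookup δ i))

interleave : ∀ {k} → ℕ → (ℕ → Fin k → ℕ) → Vec ℕ k
interleave m γ = tabulate (λ i → encode m (λ n → γ n i))

slice-interleave : ∀ {k} m (γ : ℕ → Fin k → ℕ) n → n ≤ m → slice n (interleave m γ) ≡ tabulate (γ n)
slice-interleave m γ n le =
  tabulate-cong (λ i → trans (cong (entry n) (lookup∘tabulate _ i)) (entry-encode m (λ n → γ n i) n le))

interleave-least : ∀ {k} m (δ : Vec ℕ k) (γ : ℕ → Fin k → ℕ) →
  (∀ n → n ≤ m → ¬ (slice n δ <lex tabulate (γ n))) → ¬ (δ <lex interleave m γ)
interleave-least m [] γ above ()
interleave-least m (d ∷ ds) γ above (here d<) = <-irrefl refl (<-≤-trans d< head≤d)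
  where
  head≤d : encode m (λ n → γ n zero) ≤ d
  head≤d = ≤-trans (encode-mono m (λ n le → ≮⇒≥ (λ lt → above n le (here lt)))) (encode-entries≤ m d)
interleave-least m (d ∷ ds) γ above (there ds<) = interleave-least m ds (λ n i → γ n (suc i)) tail-above ds<
  where
  tail-above : ∀ n → n ≤ m → ¬ (slice n ds <lex tabulate (λ i → γ n (suc i)))
  tail-above n le lt =
    above n le (subst (λ u → (u ∷ slice n ds) <lex tabulate (γ n)) (sym (entry-encode m (λ n → γ n zero) n le)) (there lt))

module Construction {k : ℕ} (ψ : PR (suc k)) (j i : PR 1) where

  -- ψAt (n, δ) = ψ (n, slice n δ).
  ψAt : PR (suc k)
  ψAt = comp ψ (proj zero ∷ tabulate (λ i → comp entryP (proj zero ∷ proj (suc i) ∷ [])))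

  eval-ψAt : ∀ n δ {y} → Eval ∅ ψ (n ∷ slice n δ) y → Eval ∅ ψAt (n ∷ δ) y
  eval-ψAt n δ h =
    e-comp (e-proj ∷ evalAll-tabulate _ (λ i → entry n (lookup δ i)) (λ i → e-comp (e-proj ∷ e-proj ∷ []) (eval-entry n _))) h

  eval-ψAt⁻¹ : ∀ {n δ y} → Eval ∅ ψAt (n ∷ δ) y → Eval ∅ ψ (n ∷ slice n δ) y
  eval-ψAt⁻¹ {n} {δ} (e-comp {ys = _ ∷ args} (e-proj ∷ as) h) = subst (λ u → Eval ∅ ψ (n ∷ u) _) args≡slice h
    where
    args≡slice : args ≡ slice n δ
    args≡slice = vec-ext (λ i → trans (eval-det (evalAll-lookup _ as i) (e-comp (e-proj ∷ e-proj ∷ []) (eval-entry n (lookup δ i))))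
                                      (sym (lookup∘tabulate _ i)))

  Defined : ℕ → Vec ℕ k → Set
  Defined n δ = Σ ℕ λ y → Eval ∅ ψ (n ∷ slice n δ) y

  -- allDefined (c, δ) converges exactly when ψ (n, slice n δ) converges
  -- for every n ≤ c: it evaluates ψAt (n, δ) for n = 0, …, c in turn.
  allDefined : PR (suc k)
  allDefined = prec (comp ψAt (zer ∷ projs (λ i → i)))
                    (comp ψAt (comp succ (proj zero ∷ []) ∷ projs (λ i → suc (suc i))))

  allDefined-sound : ∀ c δ → (∀ n → n ≤ c → Defined n δ) → Σ ℕ λ r → Eval ∅ allDefined (c ∷ δ) r
  allDefined-sound zero δ h =
    _ , e-prec0 (e-comp (e-zer ∷ evalAll-projs (λ i → i) δ (λ _ → refl)) (eval-ψAt 0 δ (proj₂ (h 0 z≤n))))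
  allDefined-sound (suc c) δ h =
    _ , e-precS (proj₂ (allDefined-sound c δ (λ n le → h n (m≤n⇒m≤1+n le))))
                (e-comp (e-comp (e-proj ∷ []) e-succ ∷ evalAll-projs (λ i → suc (suc i)) δ (λ _ → refl))
                        (eval-ψAt (suc c) δ (proj₂ (h (suc c) ≤-refl))))

  allDefined-complete : ∀ c {δ r} → Eval ∅ allDefined (c ∷ δ) r → ∀ n → n ≤ c → Defined n δ
  allDefined-complete zero {δ} (e-prec0 (e-comp (e-zer ∷ ps) h)) zero z≤n =
    _ , eval-ψAt⁻¹ {δ = δ} (subst (λ u → Eval ∅ ψAt (0 ∷ u) _) (sym (vec-ext (evalAll-projs⁻¹ (λ i → i) ps))) h)
  allDefined-complete (suc c) {δ} (e-precS a (e-comp (e-comp (e-proj ∷ []) e-succ ∷ ps) h)) n le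
    with m≤n⇒m<n∨m≡n le
  ... | inj₁ n<1+c = allDefined-complete c a n (≤-pred n<1+c)
  ... | inj₂ refl =
    _ , eval-ψAt⁻¹ {δ = δ} (subst (λ u → Eval ∅ ψAt (suc c ∷ u) _) (sym (vec-ext (evalAll-projs⁻¹ (λ i → suc (suc i)) ps))) h)

  -- answer (q, m, δ) = ψAt (q, δ) if q ≤ m and 0 otherwise.  The case split
  -- is a primitive recursion on the bit sg (m+1 ∸ q), so that ψ is not run
  -- at all when q > m.
  inRange : PR (suc (suc k))
  inRange = comp sgP (comp monusP (proj zero ∷ comp succ (proj (suc zero) ∷ []) ∷ []) ∷ [])

  eval-inRange : ∀ q m δ → Eval ∅ inRange (q ∷ m ∷ δ) (sg (suc m ∸ q))
  eval-inRange q m δ =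
    e-comp (e-comp (e-proj ∷ e-comp (e-proj ∷ []) e-succ ∷ []) (eval-monus q (suc m)) ∷ []) (eval-sg _)

  answer : PR (suc (suc k))
  answer = comp (prec zer (comp ψAt (proj (suc (suc zero)) ∷ projs (λ i → suc (suc (suc i))))))
                (inRange ∷ proj zero ∷ projs (λ i → suc (suc i)))

  eval-answer : ∀ (B : Set') q m δ → (q ≤ m → Eval ∅ ψ (q ∷ slice q δ) (χ (B q))) →
                Eval ∅ answer (q ∷ m ∷ δ) (χ ((B ↾ m) q))
  eval-answer B q m δ h with q ≤? m
  ... | yes q≤m =
    e-comp (subst (Eval ∅ inRange (q ∷ m ∷ δ)) (cong sg (+-∸-assoc 1 q≤m)) (eval-inRange q m δ)
              ∷ e-proj ∷ evalAll-projs _ δ (λ _ → refl))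
           (e-precS (e-prec0 e-zer) (e-comp (e-proj ∷ evalAll-projs _ δ (λ _ → refl)) (eval-ψAt q δ (h q≤m))))
  ... | no q≰m =
    e-comp (subst (Eval ∅ inRange (q ∷ m ∷ δ)) (cong sg (m≤n⇒m∸n≡0 (≰⇒> q≰m))) (eval-inRange q m δ)
              ∷ e-proj ∷ evalAll-projs _ δ (λ _ → refl))
           (e-prec0 e-zer)

  open ReplaceOracle {suc k} answer

  boundP : PR (suc k)
  boundP = comp j (proj zero ∷ [])

  -- ψA (x, δ): with m = φⱼ(x), check allDefined (m, δ), then output the
  -- sign of Φᵢ(x) run with oracle answers answer (-, m, δ).
  ψA : PR (suc k)
  ψA = comp (proj (suc zero))
            (comp allDefined (boundP ∷ projs suc)
             ∷ comp sgP (comp (compile i) (proj zero ∷ boundP ∷ projs suc) ∷ []) ∷ [])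

  ψA-01 : ∀ x (β : Vec ℕ k) y → Eval ∅ ψA (x ∷ β) y → y ≡ 0 ⊎ y ≡ 1
  ψA-01 x β y (e-comp (_ ∷ (e-comp (_ ∷ []) s ∷ [])) e-proj) = sgP-01 s

  module Correctness (A B : Set')
    (reduction : ∀ x → Σ ℕ λ m → (φ⟨ j ⟩ (x ∷ []) ↦ m) × Eval (B ↾ m) i (x ∷ []) (χ (A x)))
    (least : ∀ n → Σ (Vec ℕ k) λ γ → Σ ℕ λ y →
       (φ⟨ ψ ⟩ (n ∷ γ) ↦ y) × (∀ δ → δ <lex γ → ∀ z → ¬ (φ⟨ ψ ⟩ (n ∷ δ) ↦ z)) × χ (B n) ≡ y) where

    γ : ℕ → Fin k → ℕ
    γ n = lookup (proj₁ (least n))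

    γ≡ : ∀ n → tabulate (γ n) ≡ proj₁ (least n)
    γ≡ n = tabulate∘lookup (proj₁ (least n))

    eval-γ : ∀ n → Eval ∅ ψ (n ∷ tabulate (γ n)) (χ (B n))
    eval-γ n with least n
    ... | γₙ , y , ev , _ , refl = subst (λ u → Eval ∅ ψ (n ∷ u) y) (sym (tabulate∘lookup γₙ)) ev

    γ-least : ∀ n δ → δ <lex tabulate (γ n) → ∀ z → ¬ Eval ∅ ψ (n ∷ δ) z
    γ-least n δ lt = proj₁ (proj₂ (proj₂ (proj₂ (least n)))) δ (subst (δ <lex_) (γ≡ n) lt)

    bound : ℕ → ℕ
    bound x = proj₁ (reduction x)

    eval-boundP : ∀ x δ → Eval ∅ boundP (x ∷ δ) (bound x)
    eval-boundP x δ = e-comp (e-proj ∷ []) (proj₁ (proj₂ (reduction x)))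

    δ* : ℕ → Vec ℕ k
    δ* x = interleave (bound x) γ

    eval-slices-δ* : ∀ x n → n ≤ bound x → Eval ∅ ψ (n ∷ slice n (δ* x)) (χ (B n))
    eval-slices-δ* x n le = subst (λ u → Eval ∅ ψ (n ∷ u) (χ (B n))) (sym (slice-interleave (bound x) γ n le)) (eval-γ n)

    ψA-δ* : ∀ x → Eval ∅ ψA (x ∷ δ* x) (χ (A x))
    ψA-δ* x =
      e-comp (e-comp (eval-boundP x _ ∷ params-δ) (proj₂ (allDefined-sound (bound x) (δ* x) (λ n le → _ , eval-slices-δ* x n le)))
              ∷ e-comp (e-comp (e-proj ∷ eval-boundP x _ ∷ params-δ) simulation ∷ [])
                       (subst (Eval ∅ sgP (χ (A x) ∷ [])) (sg-χ (A x)) (eval-sg (χ (A x)))) ∷ [])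
             e-proj
      where
      params-δ : EvalAll ∅ (projs suc) (x ∷ δ* x) (δ* x)
      params-δ = evalAll-projs suc (δ* x) (λ _ → refl)
      simulation : Eval ∅ (compile i) (x ∷ bound x ∷ δ* x) (χ (A x))
      simulation = compile-sound (bound x ∷ δ* x) (λ q → eval-answer B q (bound x) (δ* x) (eval-slices-δ* x q))
                                 (proj₂ (proj₂ (reduction x)))

    ψA-defined⇒slices-defined : ∀ x δ z → Eval ∅ ψA (x ∷ δ) z → ∀ n → n ≤ bound x → Defined n δ
    ψA-defined⇒slices-defined x δ z (e-comp (e-comp (e-comp (e-proj ∷ []) jx ∷ ps) check ∷ _) _)
      with eval-det jx (proj₁ (proj₂ (reduction x)))
    ... | refl = allDefined-complete (bound x)
                   (subst (λ u → Eval ∅ allDefined (bound x ∷ u) _) (sym (vec-ext {xs = δ} (evalAll-projs⁻¹ suc ps))) check)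

    -- Below δ* x, ψA (x, -) diverges: some slice would lie below its γ n.
    ψA-minimal : ∀ x δ → δ <lex δ* x → ∀ z → ¬ Eval ∅ ψA (x ∷ δ) z
    ψA-minimal x δ lt z ev = interleave-least (bound x) δ γ slices-above lt
      where
      slices-above : ∀ n → n ≤ bound x → ¬ (slice n δ <lex tabulate (γ n))
      slices-above n le below = let (y , evn) = ψA-defined⇒slices-defined x δ z ev n le in
                                γ-least n (slice n δ) below y evn

-- Main theorem: the approximation ψA witnesses that A is ω^k-c.e., with
-- least convergence point δ* x at each x.
mainTheorem11 : (k : ℕ) → 0 < k → (A B : Set') → A ≤bT B → ωPow-ce k B → ωPow-ce k A
mainTheorem11 k _ A B (i , j , _ , reduction) (ψ , _ , least) =
  ψA , ψA-01 , λ x → δ* x , χ (A x) , ψA-δ* x , ψA-minimal x , refl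
  where
  open Construction ψ j i
  open Correctness A B reduction least
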